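{- Let $G$ be an undirected graph with positive edge weights, sources $s_1,s_2$ and targets $t_1,t_2$. Any edge-agreeing pair $\langle P_1,P_2\rangle$ is agreeing, i.e., $P_1$ and $P_2$ agree.
   Context: For $i\in\{1,2\}$, $G_i$ is the $s_i$-shortest paths DAG of $G$: the directed graph on the vertices of $G$ containing $(u,v)$ iff $(u,v)$ is traversed by some shortest $(s_i,v)$-path in $G$. A pair $\langle P_1,P_2\rangle$ is edge-agreeing if each $P_i$ is an $(s_i,t_i)$-path in $G_i$ and $P_1,P_2$ traverse a common edge in the same direction. Paths $P_1,P_2$ agree if $|P_1\cap P_2|\ge 2$ and the first vertex of $P_1$ lying in $P_1\cap P_2$ is also the first vertex of $P_2$ lying in $P_1\cap P_2$.
   Formalization: The positive edge weights of G are rational. -}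

module Defs where

open import Data.Nat using (ℕ)
open import Data.Fin using (Fin)
open import Data.List using (List; []; _∷_; _++_; head; last)
open import Data.Maybe using (just)
open import Data.Product using (Σ; ∃; ∃-syntax; _×_)
open import Data.Rational using (ℚ; 0ℚ; _+_; _≤_; _<_)
open import Data.List.Relation.Unary.Linked using (Linked)
open import Data.List.Relation.Unary.All using (All)
open import Data.List.Relation.Unary.Unique.Propositional using (Unique)
open import Data.List.Membership.Propositional using (_∈_; _∉_)
open import Relation.Binary.PropositionalEquality using (_≡_; _≢_)
open import Relation.Nullary using (¬_)

record WGraph : Set₁ where
  field
    n        : ℕ
    Edge     : Fin n → Fin n → Set
    w        : Fin n → Fin n → ℚ
    Edge-sym : ∀ {u v} → Edge u v → Edge v u
    w-sym    : ∀ u v → w u v ≡ w v u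
    w-pos    : ∀ {u v} → Edge u v → 0ℚ < w u v

module _ {V : Set} where

  -- A (simple) path from s to t in the (directed) graph with arc relation R,
  -- given as its list of vertices.
  IsPath : (V → V → Set) → V → V → List V → Set
  IsPath R s t xs = (head xs ≡ just s) × (last xs ≡ just t) × Linked R xs × Unique xs

  Traverses : V → V → List V → Set
  Traverses u v xs = ∃[ ys ] ∃[ zs ] (xs ≡ ys ++ (u ∷ v ∷ zs))

module _ (G : WGraph) where
  open WGraph G

  weight : List (Fin n) → ℚ
  weight []           = 0ℚ
  weight (x ∷ [])     = 0ℚ
  weight (x ∷ y ∷ xs) = w x y + weight (y ∷ xs)

  IsShortestPath : Fin n → Fin n → List (Fin n) → Set
  IsShortestPath s v P =
    IsPath Edge s v P × (∀ Q → IsPath Edge s v Q → weight P ≤ weight Q)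

  SPDag : Fin n → Fin n → Fin n → Set
  SPDag s u v = ∃[ P ] (IsShortestPath s v P × Traverses u v P)

  EdgeAgreeing : (s₁ t₁ s₂ t₂ : Fin n) → List (Fin n) → List (Fin n) → Set
  EdgeAgreeing s₁ t₁ s₂ t₂ P₁ P₂ =
    IsPath (SPDag s₁) s₁ t₁ P₁ × IsPath (SPDag s₂) s₂ t₂ P₂ ×
    (∃[ u ] ∃[ v ] (Traverses u v P₁ × Traverses u v P₂))

module _ {V : Set} where

  FirstCommon : V → List V → List V → Set
  FirstCommon f P Q = f ∈ Q × ∃[ ys ] ∃[ zs ] ((P ≡ ys ++ (f ∷ zs)) × All (_∉ Q) ys)

  Agree : List V → List V → Set
  Agree P Q =
    (∃[ x ] ∃[ y ] (x ≢ y × x ∈ P × x ∈ Q × y ∈ P × y ∈ Q)) ×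
    (∀ f → FirstCommon f P Q → FirstCommon f Q P)

{-# OPTIONS --safe #-}
module Submission where

-- Every arc (x, y) of the s-shortest-paths DAG satisfies d(s, y) = d(s, x) + w(x, y), so along
-- a path P of that DAG the weight of the prefix ending at x is d(s, x), and the segment of P
-- between two of its vertices is a lightest walk between them.  Hence for two vertices x, y
-- common to P₁ and P₂ the two segments weigh the same, i.e. the prefix weights satisfy
-- d₁(y) − d₁(x) = ± (d₂(y) − d₂(x)).  Along the shared edge u → v both prefix weights grow by
-- w(u, v) > 0, which excludes the minus sign relative to u; so d₁ − d₂ is constant on P₁ ∩ P₂.
-- If the first common vertex f of P₁ differed from the first common vertex b of P₂, then
-- d₁(f) < d₁(b) and d₂(b) < d₂(f), contradicting that constancy.

open import Defs
open import Data.Fin using (Fin)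
open import Data.List using (List)

open import Algebra.Bundles using (CommutativeMonoid)
open import Data.Bool using (if_then_else_)
open import Data.Empty using (⊥-elim)
open import Data.Fin.Properties using (_≟_)
open import Data.List using ([]; _∷_; _++_; _∷ʳ_; [_]; head; last; reverse)
open import Data.List.Properties using (++-assoc; unfold-reverse)
open import Data.List.Membership.Propositional using (_∈_; _∉_)
open import Data.List.Membership.Propositional.Properties using (∈-∃++; ∈-++⁻; ∈-++⁺ʳ)
open import Data.List.Relation.Unary.All as All using (All; []; _∷_)
import Data.List.Relation.Unary.All.Properties as All
open import Data.List.Relation.Unary.AllPairs using ([]; _∷_)
open import Data.List.Relation.Unary.Any using (here; there)
open import Data.List.Relation.Unary.First as First using (first)
open import Data.List.Relation.Unary.First.Properties using (toView)
open import Data.List.Relation.Unary.Linked as Linked using (Linked; []; [-]; _∷_)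
open import Data.List.Relation.Unary.Unique.Propositional using (Unique)
open import Data.Maybe using (just)
open import Data.Product using (∃-syntax; _×_; _,_; proj₁)
open import Data.Rational using (ℚ; 0ℚ; _+_; _≤_; _<_; -_)
import Data.Rational.Properties as ℚ
open import Data.Rational.Solver using (module +-*-Solver)
open import Data.Sum as Sum using (_⊎_; inj₁; inj₂)
open import Function using (_∘_)
open import Relation.Binary.Definitions using (DecidableEquality; Symmetric)
open import Relation.Binary.PropositionalEquality
  using (_≡_; _≢_; refl; sym; trans; cong; cong₂; subst; subst₂; module ≡-Reasoning)
open import Relation.Nullary using (yes; no; does)
open import Relation.Nullary.Decidable using (toSum)

open import Algebra.Properties.Group ℚ.+-0-group using (∙-cancelʳ)
open import Algebra.Properties.CommutativeSemigroup
  (CommutativeMonoid.commutativeSemigroup ℚ.+-0-commutativeMonoid)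
  using (x∙yz≈xz∙y; xy∙z≈xz∙y; interchange)

p≤p+q : ∀ p {q} → 0ℚ ≤ q → p ≤ p + q
p≤p+q p {q} 0≤q = subst (_≤ p + q) (ℚ.+-identityʳ p) (ℚ.+-monoʳ-≤ p 0≤q)

p≤q+p : ∀ p {q} → 0ℚ ≤ q → p ≤ q + p
p≤q+p p {q} 0≤q = subst (_≤ q + p) (ℚ.+-identityˡ p) (ℚ.+-monoˡ-≤ p 0≤q)

p<p+q : ∀ p {q} → 0ℚ < q → p < p + q
p<p+q p {q} 0<q = subst (_< p + q) (ℚ.+-identityʳ p) (ℚ.+-monoʳ-< p 0<q)

+-cancelˡ-≤ : ∀ p {q r} → p + q ≤ p + r → q ≤ r
+-cancelˡ-≤ p {q} {r} p+q≤p+r =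
  subst₂ _≤_ (neg-cancel q) (neg-cancel r) (ℚ.+-monoʳ-≤ (- p) p+q≤p+r)
  where
  open +-*-Solver
  neg-cancel : ∀ x → - p + (p + x) ≡ x
  neg-cancel = solve 2 (λ p x → :- p :+ (p :+ x) := x) refl p

AbsDiff : ℚ → ℚ → ℚ → Set
AbsDiff a b σ = b ≡ a + σ ⊎ a ≡ b + σ

absDiff-≤ : ∀ {a b c σ} → b ≤ a + c → a ≤ b + c → AbsDiff a b σ → σ ≤ c
absDiff-≤ {a = a} b≤a+c _ (inj₁ refl) = +-cancelˡ-≤ a b≤a+c
absDiff-≤ {b = b} _ a≤b+c (inj₂ refl) = +-cancelˡ-≤ b a≤b+c

-- a′ − a = b′ − b, and a′ − a = b − b′, written without subtraction.
SameShift OppositeShift : ℚ → ℚ → ℚ → ℚ → Set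
SameShift a a′ b b′ = a + b′ ≡ a′ + b
OppositeShift a a′ b b′ = a + b ≡ a′ + b′

absDiff⇒shift : ∀ {a a′ b b′ σ} → AbsDiff a a′ σ → AbsDiff b b′ σ →
  SameShift a a′ b b′ ⊎ OppositeShift a a′ b b′
absDiff⇒shift {a} {b = b} {σ = σ} (inj₁ refl) (inj₁ refl) = inj₁ (x∙yz≈xz∙y a b σ)
absDiff⇒shift {a} {b′ = b′} {σ} (inj₁ refl) (inj₂ refl) = inj₂ (x∙yz≈xz∙y a b′ σ)
absDiff⇒shift {a′ = a′} {b} {σ = σ} (inj₂ refl) (inj₁ refl) = inj₂ (sym (x∙yz≈xz∙y a′ b σ))
absDiff⇒shift {a′ = a′} {b′ = b′} {σ} (inj₂ refl) (inj₂ refl) = inj₁ (sym (x∙yz≈xz∙y a′ b′ σ))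

-- Two opposite shifts would force c = − c.
sameShift-stable : ∀ {a a′ a″ b b′ b″ c} → 0ℚ < c → a″ ≡ a′ + c → b″ ≡ b′ + c →
  SameShift a a′ b b′ ⊎ OppositeShift a a′ b b′ →
  SameShift a a″ b b″ ⊎ OppositeShift a a″ b b″ →
  SameShift a a′ b b′
sameShift-stable _ _ _ (inj₁ same) _ = same
sameShift-stable {a} {a′} {b = b} {b′} {c = c} _ refl refl (inj₂ _) (inj₁ same″) =
  ∙-cancelʳ c (a + b′) (a′ + b) (trans (ℚ.+-assoc a b′ c) (trans same″ (xy∙z≈xz∙y a′ c b)))
sameShift-stable {a} {a′} {b = b} {b′} {c = c} 0<c refl refl (inj₂ opp) (inj₂ opp″) =
  ⊥-elim (ℚ.<-irrefl (trans (sym opp) (trans opp″ (interchange a′ c b′ c)))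
                     (p<p+q (a′ + b′) 0<c+c))
  where
  0<c+c : 0ℚ < c + c
  0<c+c = subst (_< c + c) (ℚ.+-identityʳ 0ℚ) (ℚ.+-mono-< 0<c 0<c)

sameShift-trans : ∀ {a a′ a₀ b b′ b₀} →
  SameShift a a₀ b b₀ → SameShift a′ a₀ b′ b₀ → SameShift a a′ b b′
sameShift-trans {a} {a′} {a₀} {b} {b′} {b₀} s s′ = ∙-cancelʳ b₀ (a + b′) (a′ + b) (begin
  (a + b′) + b₀   ≡⟨ xy∙z≈xz∙y a b′ b₀ ⟩
  (a + b₀) + b′   ≡⟨ cong (_+ b′) s ⟩
  (a₀ + b) + b′   ≡⟨ xy∙z≈xz∙y a₀ b b′ ⟩
  (a₀ + b′) + b   ≡⟨ cong (_+ b) (sym s′) ⟩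
  (a′ + b₀) + b   ≡⟨ xy∙z≈xz∙y a′ b₀ b ⟩
  (a′ + b) + b₀   ∎)
  where open ≡-Reasoning

module _ {V : Set} where

  private variable
    s t x y : V
    A B P Q : List V
    R : V → V → Set

  Precedes : V → V → List V → Set
  Precedes x y P = ∃[ A ] ∃[ Z ] (P ≡ A ++ x ∷ Z × y ∈ x ∷ Z)

  precedes-∷ : ∀ {a} → Precedes x y P → Precedes x y (a ∷ P)
  precedes-∷ {a = a} (A , Z , refl , y∈xZ) = a ∷ A , Z , refl , y∈xZ

  precedes-total : ∀ P → x ∈ P → y ∈ P → Precedes x y P ⊎ Precedes y x P
  precedes-total (_ ∷ P) (here refl) y∈ = inj₁ ([] , P , refl , y∈)
  precedes-total (_ ∷ P) (there x∈P) (here refl) = inj₂ ([] , P , refl , there x∈P)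
  precedes-total (_ ∷ P) (there x∈P) (there y∈P) =
    Sum.map precedes-∷ precedes-∷ (precedes-total P x∈P y∈P)

  traverses⇒∈ : Traverses x y P → x ∈ P × y ∈ P
  traverses⇒∈ (A , _ , refl) = ∈-++⁺ʳ A (here refl) , ∈-++⁺ʳ A (there (here refl))

  head-++-∷ : ∀ A → head (A ++ x ∷ B) ≡ head (A ∷ʳ x)
  head-++-∷ [] = refl
  head-++-∷ (_ ∷ _) = refl

  head-++ˡ : ∀ A → head A ≡ just x → head (A ++ B) ≡ just x
  head-++ˡ (_ ∷ _) refl = refl

  last-++-∷ : ∀ A → last (A ++ x ∷ B) ≡ last (x ∷ B)
  last-++-∷ [] = refl
  last-++-∷ (_ ∷ []) = refl
  last-++-∷ (_ ∷ a ∷ A) = last-++-∷ (a ∷ A)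

  last-reverse : ∀ x A → last (reverse (x ∷ A)) ≡ just x
  last-reverse x A = trans (cong last (unfold-reverse x A)) (last-++-∷ (reverse A))

  head-reverse : ∀ A → last A ≡ just x → head (reverse A) ≡ just x
  head-reverse (_ ∷ []) refl = refl
  head-reverse (a ∷ b ∷ A) last≡x = trans (cong head (unfold-reverse a (b ∷ A)))
    (head-++ˡ (reverse (b ∷ A)) (head-reverse (b ∷ A) last≡x))

  linked-prefix : ∀ A → Linked R (A ++ x ∷ B) → Linked R (A ∷ʳ x)
  linked-prefix [] _ = [-]
  linked-prefix (_ ∷ []) (r ∷ _) = r ∷ [-]
  linked-prefix (_ ∷ a ∷ A) (r ∷ lk) = r ∷ linked-prefix (a ∷ A) lk

  linked-++⁻ʳ : ∀ A → Linked R (A ++ B) → Linked R B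
  linked-++⁻ʳ [] lk = lk
  linked-++⁻ʳ (_ ∷ A) lk = linked-++⁻ʳ A (Linked.tail lk)

  linked-join : ∀ A → Linked R (A ∷ʳ x) → Linked R (x ∷ B) → Linked R (A ++ x ∷ B)
  linked-join [] _ lk = lk
  linked-join (_ ∷ []) (r ∷ _) lk = r ∷ lk
  linked-join (_ ∷ a ∷ A) (r ∷ lk₁) lk = r ∷ linked-join (a ∷ A) lk₁ lk

  linked-traverses : Linked R P → Traverses x y P → R x y
  linked-traverses lk (A , _ , refl) = Linked.head (linked-++⁻ʳ A lk)

  linked-∷ʳ : ∀ A → Linked R A → last A ≡ just x → R x y → Linked R (A ∷ʳ y)
  linked-∷ʳ (_ ∷ []) [-] refl r = r ∷ [-]
  linked-∷ʳ (_ ∷ a ∷ A) (r′ ∷ lk) last≡x r = r′ ∷ linked-∷ʳ (a ∷ A) lk last≡x r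

  linked-reverse : Symmetric R → Linked R A → Linked R (reverse A)
  linked-reverse _ [] = []
  linked-reverse _ [-] = [-]
  linked-reverse {A = a ∷ b ∷ A} R-sym (r ∷ lk) =
    subst (Linked _) (sym (unfold-reverse a (b ∷ A)))
      (linked-∷ʳ (reverse (b ∷ A)) (linked-reverse R-sym lk) (last-reverse b A) (R-sym r))

  unique-++⁻ʳ : ∀ A → Unique (A ++ B) → Unique B
  unique-++⁻ʳ [] uniq = uniq
  unique-++⁻ʳ (_ ∷ A) (_ ∷ uniq) = unique-++⁻ʳ A uniq

  unique-prefix : ∀ A → Unique (A ++ x ∷ B) → Unique (A ∷ʳ x)
  unique-prefix [] _ = [] ∷ []
  unique-prefix {x = x} {B = B} (_ ∷ A) (a≢ ∷ uniq) =
    All.++⁻ˡ (A ∷ʳ x) (subst (All _) (sym (++-assoc A [ x ] B)) a≢) ∷ unique-prefix A uniq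

  unique⇒∉-prefix : ∀ A → Unique (A ++ x ∷ B) → x ∉ A
  unique⇒∉-prefix (_ ∷ A) (a≢ ∷ _) (here refl) = All.lookup a≢ (∈-++⁺ʳ A (here refl)) refl
  unique⇒∉-prefix (_ ∷ A) (_ ∷ uniq) (there x∈A) = unique⇒∉-prefix A uniq x∈A

  unique-traverses : Unique P → Traverses x y P → x ≢ y
  unique-traverses uniq (A , _ , refl) with (x≢ ∷ _) ∷ _ ← unique-++⁻ʳ A uniq = x≢

  path-linked : IsPath R s t P → Linked R P
  path-linked (_ , _ , lk , _) = lk

  path-unique : IsPath R s t P → Unique P
  path-unique (_ , _ , _ , uniq) = uniq

  path-prefix : ∀ A → IsPath R s t (A ++ x ∷ B) → IsPath R s x (A ∷ʳ x)
  path-prefix A (h , _ , lk , uniq) =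
    trans (sym (head-++-∷ A)) h , last-++-∷ A , linked-prefix A lk , unique-prefix A uniq

  path-suffix : ∀ A → IsPath R s t (A ++ x ∷ B) → IsPath R x t (x ∷ B)
  path-suffix A (_ , l , lk , uniq) =
    refl , trans (sym (last-++-∷ A)) l , linked-++⁻ʳ A lk , unique-++⁻ʳ A uniq

  firstCommon⇒∈ : FirstCommon x P Q → x ∈ P
  firstCommon⇒∈ (_ , A , _ , refl , _) = ∈-++⁺ʳ A (here refl)

  firstCommon-precedes : FirstCommon x P Q → y ∈ P → y ∈ Q → Precedes x y P
  firstCommon-precedes (_ , A , Z , refl , A∉Q) y∈P y∈Q with ∈-++⁻ A y∈P
  ... | inj₁ y∈A = ⊥-elim (All.lookup A∉Q y∈A y∈Q)
  ... | inj₂ y∈xZ = A , Z , refl , y∈xZ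

  module _ (_≟_ : DecidableEquality V) where
    open import Data.List.Membership.DecPropositional _≟_ using (_∈?_)

    firstCommon-exists : ∀ P Q → x ∈ P → x ∈ Q → ∃[ f ] FirstCommon f P Q
    firstCommon-exists P Q x∈P x∈Q with first (λ y → Sum.swap (toSum (y ∈? Q))) P
    ... | inj₂ P∉Q = ⊥-elim (All.lookup P∉Q x∈P x∈Q)
    ... | inj₁ fst with toView fst
    ... | First._++_∷_ A∉Q f∈Q Z = _ , f∈Q , _ , Z , refl , A∉Q

module _ (G : WGraph) where
  open WGraph G
  open import Data.List.Membership.DecPropositional (_≟_ {n}) using (_∈?_)

  private variable
    s t u v x y : Fin n
    A B P Q W : List (Fin n)

  IsWalk : Fin n → Fin n → List (Fin n) → Set
  IsWalk x y W = head W ≡ just x × last W ≡ just y × Linked Edge W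

  path⇒walk : IsPath Edge x y P → IsWalk x y P
  path⇒walk (h , l , lk , _) = h , l , lk

  walk-++ : ∀ A → IsWalk s x (A ∷ʳ x) → IsWalk x t (x ∷ W) → IsWalk s t (A ++ x ∷ W)
  walk-++ A (h , _ , lk₁) (_ , l , lk₂) =
    trans (head-++-∷ A) h , trans (last-++-∷ A) l , linked-join A lk₁ lk₂

  reverse-walk : ∀ W → IsWalk x y W → IsWalk y x (reverse W)
  reverse-walk (a ∷ W) (refl , l , lk) =
    head-reverse (a ∷ W) l , last-reverse a W , linked-reverse Edge-sym lk

  weight-++ : ∀ A → weight G (A ++ x ∷ B) ≡ weight G (A ∷ʳ x) + weight G (x ∷ B)
  weight-++ {x} {B} [] = sym (ℚ.+-identityˡ (weight G (x ∷ B)))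
  weight-++ {x} {B} (a ∷ []) = cong (_+ weight G (x ∷ B)) (sym (ℚ.+-identityʳ (w a x)))
  weight-++ (a ∷ b ∷ A) =
    trans (cong (w a b +_) (weight-++ (b ∷ A))) (sym (ℚ.+-assoc (w a b) _ _))

  weight-∷ʳ : ∀ A → last A ≡ just x → weight G (A ∷ʳ y) ≡ weight G A + w x y
  weight-∷ʳ {y = y} (a ∷ []) refl =
    trans (ℚ.+-identityʳ (w a y)) (sym (ℚ.+-identityˡ (w a y)))
  weight-∷ʳ (a ∷ b ∷ A) last≡x =
    trans (cong (w a b +_) (weight-∷ʳ (b ∷ A) last≡x)) (sym (ℚ.+-assoc (w a b) _ _))

  weight-reverse : ∀ W → weight G (reverse W) ≡ weight G W
  weight-reverse [] = refl
  weight-reverse (_ ∷ []) = refl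
  weight-reverse (a ∷ b ∷ W) = begin
    weight G (reverse (a ∷ b ∷ W))      ≡⟨ cong (weight G) (unfold-reverse a (b ∷ W)) ⟩
    weight G (reverse (b ∷ W) ∷ʳ a)     ≡⟨ weight-∷ʳ (reverse (b ∷ W)) (last-reverse b W) ⟩
    weight G (reverse (b ∷ W)) + w b a  ≡⟨ cong₂ _+_ (weight-reverse (b ∷ W)) (w-sym b a) ⟩
    weight G (b ∷ W) + w a b            ≡⟨ ℚ.+-comm (weight G (b ∷ W)) (w a b) ⟩
    weight G (a ∷ b ∷ W)                ∎
    where open ≡-Reasoning

  weight-nonneg : Linked Edge W → 0ℚ ≤ weight G W
  weight-nonneg [] = ℚ.≤-refl
  weight-nonneg [-] = ℚ.≤-refl
  weight-nonneg {W = a ∷ b ∷ W} (e ∷ lk) = subst (_≤ w a b + weight G (b ∷ W))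
    (ℚ.+-identityʳ 0ℚ) (ℚ.+-mono-≤ (ℚ.<⇒≤ (w-pos e)) (weight-nonneg lk))

  weight-pos : IsWalk x y W → x ≢ y → 0ℚ < weight G W
  weight-pos {W = _ ∷ []} (refl , refl , _) x≢y = ⊥-elim (x≢y refl)
  weight-pos {W = a ∷ b ∷ W} (_ , _ , e ∷ lk) _ = subst (_< w a b + weight G (b ∷ W))
    (ℚ.+-identityʳ 0ℚ) (ℚ.+-mono-<-≤ (w-pos e) (weight-nonneg lk))

  weight-suffix-≤ : ∀ A → Linked Edge (A ++ x ∷ B) → weight G (x ∷ B) ≤ weight G (A ++ x ∷ B)
  weight-suffix-≤ A lk =
    subst (_ ≤_) (sym (weight-++ A)) (p≤q+p _ (weight-nonneg (linked-prefix A lk)))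

  path-∷ : Edge x y → IsPath Edge y t Q → x ∉ Q →
           IsPath Edge x t (x ∷ Q) × weight G (x ∷ Q) ≡ w x y + weight G Q
  path-∷ {Q = _ ∷ _} e (refl , l , lk , uniq) x∉Q =
    (refl , l , e ∷ lk , All.¬Any⇒All¬ _ x∉Q ∷ uniq) , refl

  walk⇒path : ∀ W → IsWalk x y W → ∃[ Q ] (IsPath Edge x y Q × weight G Q ≤ weight G W)
  walk⇒path (a ∷ []) (refl , refl , _) = [ a ] , (refl , refl , [-] , [] ∷ []) , ℚ.≤-refl
  walk⇒path (a ∷ b ∷ W) (refl , l , e ∷ lk) with walk⇒path (b ∷ W) (refl , l , lk)
  ... | Q , q , Q≤W with a ∈? Q
  ... | no a∉Q with q′ , eq ← path-∷ e q a∉Q =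
    a ∷ Q , q′ , subst (_≤ _) (sym eq) (ℚ.+-monoʳ-≤ (w a b) Q≤W)
  ... | yes a∈Q with A , B , refl ← ∈-∃++ a∈Q =
    a ∷ B , path-suffix A q ,
    ℚ.≤-trans (weight-suffix-≤ A (path-linked q)) (ℚ.≤-trans Q≤W (p≤q+p _ (ℚ.<⇒≤ (w-pos e))))

  prefixWeight : List (Fin n) → Fin n → ℚ
  prefixWeight [] _ = 0ℚ
  prefixWeight (_ ∷ []) _ = 0ℚ
  prefixWeight (a ∷ b ∷ P) y = if does (a ≟ y) then 0ℚ else w a b + prefixWeight (b ∷ P) y

  prefixWeight-head : ∀ P → prefixWeight (x ∷ P) x ≡ 0ℚ
  prefixWeight-head [] = refl
  prefixWeight-head {x} (_ ∷ _) with x ≟ x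
  ... | yes _ = refl
  ... | no x≢x = ⊥-elim (x≢x refl)

  prefixWeight-∷ : ∀ u P → x ≢ y → prefixWeight (x ∷ u ∷ P) y ≡ w x u + prefixWeight (u ∷ P) y
  prefixWeight-∷ {x} {y} _ _ x≢y with x ≟ y
  ... | yes x≡y = ⊥-elim (x≢y x≡y)
  ... | no _ = refl

  prefixWeight-∉ : ∀ A → x ∉ A → prefixWeight (A ++ x ∷ B) x ≡ weight G (A ∷ʳ x)
  prefixWeight-∉ {B = B} [] _ = prefixWeight-head B
  prefixWeight-∉ {x} {B} (a ∷ []) x∉A =
    trans (prefixWeight-∷ x B λ { refl → x∉A (here refl) })
          (cong (w a x +_) (prefixWeight-head B))
  prefixWeight-∉ {x} {B} (a ∷ b ∷ A) x∉A =
    trans (prefixWeight-∷ b (A ++ x ∷ B) λ { refl → x∉A (here refl) })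
          (cong (w a b +_) (prefixWeight-∉ (b ∷ A) (x∉A ∘ there)))

  prefixWeight-segment : ∀ A Z {C} → let P = A ++ u ∷ Z ++ x ∷ C in
    Unique P → prefixWeight P x ≡ prefixWeight P u + weight G ((u ∷ Z) ∷ʳ x)
  prefixWeight-segment {u} {x} A Z {C} uniq = begin
    prefixWeight (A ++ u ∷ Z ++ x ∷ C) x    ≡⟨ cong (λ L → prefixWeight L x) (sym assoc) ⟩
    prefixWeight ((A ++ u ∷ Z) ++ x ∷ C) x  ≡⟨ prefixWeight-∉ (A ++ u ∷ Z) x∉ ⟩
    weight G ((A ++ u ∷ Z) ∷ʳ x)            ≡⟨ cong (weight G) (++-assoc A (u ∷ Z) [ x ]) ⟩
    weight G (A ++ (u ∷ Z) ∷ʳ x)            ≡⟨ weight-++ A ⟩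
    weight G (A ∷ʳ u) + weight G ((u ∷ Z) ∷ʳ x)
      ≡⟨ cong (_+ weight G ((u ∷ Z) ∷ʳ x)) (sym (prefixWeight-∉ A (unique⇒∉-prefix A uniq))) ⟩
    prefixWeight (A ++ u ∷ Z ++ x ∷ C) u + weight G ((u ∷ Z) ∷ʳ x) ∎
    where
    open ≡-Reasoning
    assoc : (A ++ u ∷ Z) ++ x ∷ C ≡ A ++ u ∷ Z ++ x ∷ C
    assoc = ++-assoc A (u ∷ Z) (x ∷ C)
    x∉ : x ∉ A ++ u ∷ Z
    x∉ = unique⇒∉-prefix (A ++ u ∷ Z) (subst Unique (sym assoc) uniq)

  prefixWeight-traverses : Unique P → Traverses x y P →
    prefixWeight P y ≡ prefixWeight P x + w x y
  prefixWeight-traverses {x = x} {y} uniq (A , B , refl) =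
    trans (prefixWeight-segment A [] uniq)
          (cong (prefixWeight (A ++ x ∷ y ∷ B) x +_) (ℚ.+-identityʳ (w x y)))

  segment : IsPath Edge s t P → Precedes x y P →
    ∃[ W ] (IsWalk x y W × prefixWeight P y ≡ prefixWeight P x + weight G W)
  segment {x = x} _ (_ , _ , refl , here refl) =
    [ x ] , (refl , refl , [-]) , sym (ℚ.+-identityʳ _)
  segment {x = x} {y} p (A , _ , refl , there y∈Z) with Z , _ , refl ← ∈-∃++ y∈Z =
    (x ∷ Z) ∷ʳ y , path⇒walk (path-prefix (x ∷ Z) (path-suffix A p)) ,
    prefixWeight-segment A Z (path-unique p)

  segment-absDiff : IsPath Edge s t P → x ∈ P → y ∈ P →
    ∃[ W ] (IsWalk x y W × AbsDiff (prefixWeight P x) (prefixWeight P y) (weight G W))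
  segment-absDiff {P = P} {x} {y} p x∈P y∈P with precedes-total P x∈P y∈P
  ... | inj₁ x≺y with W , walk , eq ← segment p x≺y = W , walk , inj₁ eq
  ... | inj₂ y≺x with W , walk , eq ← segment p y≺x =
    reverse W , reverse-walk W walk ,
    inj₂ (trans eq (cong (prefixWeight P y +_) (sym (weight-reverse W))))

  prefixWeight-< : IsPath Edge s t P → Precedes x y P → x ≢ y →
    prefixWeight P x < prefixWeight P y
  prefixWeight-< p x≺y x≢y with _ , walk , eq ← segment p x≺y =
    subst (_ <_) (sym eq) (p<p+q _ (weight-pos walk x≢y))

  dagPath⇒path : IsPath (SPDag G s) s t P → IsPath Edge s t P
  dagPath⇒path (h , l , lk , uniq) =
    h , l , Linked.map (λ (_ , (r , _) , x→y) → linked-traverses (path-linked r) x→y) lk , uniq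

  arc-bound : SPDag G s x y →
    ∃[ R ] (IsPath Edge s x R × ∀ Q → IsPath Edge s y Q → weight G R + w x y ≤ weight G Q)
  arc-bound {x = x} {y} (_ , (r , r-shortest) , A , B , refl) =
    A ∷ʳ x , path-prefix A r , λ Q q → ℚ.≤-trans bound (r-shortest Q q)
    where
    bound : weight G (A ∷ʳ x) + w x y ≤ weight G (A ++ x ∷ y ∷ B)
    bound = subst (_ ≤_) (sym (weight-++ A)) (ℚ.+-monoʳ-≤ (weight G (A ∷ʳ x))
      (p≤p+q (w x y) (weight-nonneg (Linked.tail (linked-++⁻ʳ A (path-linked r))))))

  ShortestAt : Fin n → List (Fin n) → Fin n → Set
  ShortestAt s P x = ∀ Q → IsPath Edge s x Q → prefixWeight P x ≤ weight G Q

  shortestAt-arc : Unique P → Traverses x y P → SPDag G s x y →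
    ShortestAt s P x → ShortestAt s P y
  shortestAt-arc {x = x} {y} uniq x→y arc sx Q q with R , r , R+w≤Q ← arc-bound arc =
    subst (_≤ weight G Q) (sym (prefixWeight-traverses uniq x→y))
      (ℚ.≤-trans (ℚ.+-monoˡ-≤ (w x y) (sx R r)) (R+w≤Q Q q))

  shortestAt-along : ∀ A → Unique P → P ≡ A ++ x ∷ B → Linked (SPDag G s) (x ∷ B) →
    ShortestAt s P x → All (ShortestAt s P) (x ∷ B)
  shortestAt-along _ _ _ [-] sx = sx ∷ []
  shortestAt-along {x = x} {B = y ∷ B} A uniq refl (arc ∷ lk) sx =
    sx ∷ shortestAt-along (A ∷ʳ x) uniq (sym (++-assoc A [ x ] (y ∷ B))) lk
           (shortestAt-arc uniq (A , B , refl) arc sx)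

  dagPath-shortestAt : IsPath (SPDag G s) s t P → All (ShortestAt s P) P
  dagPath-shortestAt {P = _ ∷ P} (refl , _ , lk , uniq) = shortestAt-along [] uniq refl lk
    λ Q q → subst (_≤ weight G Q) (sym (prefixWeight-head P)) (weight-nonneg (path-linked q))

  dagPath-triangle : IsPath (SPDag G s) s t P → x ∈ P → y ∈ P → ∀ W → IsWalk x y W →
    prefixWeight P y ≤ prefixWeight P x + weight G W
  dagPath-triangle {x = x} {y} p x∈P y∈P (_ ∷ W) walk@(refl , _)
    with A , B , refl ← ∈-∃++ x∈P
    with Q , q , Q≤ ← walk⇒path (A ++ x ∷ W)
                         (walk-++ A (path⇒walk (path-prefix A (dagPath⇒path p))) walk) = begin
      prefixWeight P′ y                     ≤⟨ All.lookup (dagPath-shortestAt p) y∈P Q q ⟩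
      weight G Q                            ≤⟨ Q≤ ⟩
      weight G (A ++ x ∷ W)                 ≡⟨ weight-++ A ⟩
      weight G (A ∷ʳ x) + weight G (x ∷ W)  ≡⟨ cong (_+ weight G (x ∷ W)) (sym x-prefix) ⟩
      prefixWeight P′ x + weight G (x ∷ W)  ∎
    where
    open ℚ.≤-Reasoning
    P′ : List (Fin n)
    P′ = A ++ x ∷ B
    x-prefix : prefixWeight P′ x ≡ weight G (A ∷ʳ x)
    x-prefix = prefixWeight-∉ A (unique⇒∉-prefix A (path-unique p))

  dagPath-geodesic : ∀ {σ} → IsPath (SPDag G s) s t P → x ∈ P → y ∈ P → IsWalk x y W →
    AbsDiff (prefixWeight P x) (prefixWeight P y) σ → σ ≤ weight G W
  dagPath-geodesic {P = P} {y = y} {W = W} p x∈P y∈P walk = absDiff-≤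
    (dagPath-triangle p x∈P y∈P W walk)
    (subst (_ ≤_) (cong (prefixWeight P y +_) (weight-reverse W))
      (dagPath-triangle p y∈P x∈P (reverse W) (reverse-walk W walk)))

  module _ {s₁ t₁ s₂ t₂ : Fin n} {P₁ P₂ : List (Fin n)}
           (p₁ : IsPath (SPDag G s₁) s₁ t₁ P₁) (p₂ : IsPath (SPDag G s₂) s₂ t₂ P₂) where

    private
      d₁ d₂ : Fin n → ℚ
      d₁ = prefixWeight P₁
      d₂ = prefixWeight P₂

    common-shift : x ∈ P₁ → x ∈ P₂ → y ∈ P₁ → y ∈ P₂ →
      SameShift (d₁ x) (d₁ y) (d₂ x) (d₂ y) ⊎ OppositeShift (d₁ x) (d₁ y) (d₂ x) (d₂ y)
    common-shift {x} {y} x∈P₁ x∈P₂ y∈P₁ y∈P₂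
      with W₁ , walk₁ , diff₁ ← segment-absDiff (dagPath⇒path p₁) x∈P₁ y∈P₁
      with W₂ , walk₂ , diff₂ ← segment-absDiff (dagPath⇒path p₂) x∈P₂ y∈P₂ =
      absDiff⇒shift diff₁ (subst (AbsDiff (d₂ x) (d₂ y)) W₂≡W₁ diff₂)
      where
      W₂≡W₁ : weight G W₂ ≡ weight G W₁
      W₂≡W₁ = ℚ.≤-antisym (dagPath-geodesic p₂ x∈P₂ y∈P₂ walk₁ diff₂)
                          (dagPath-geodesic p₁ x∈P₁ y∈P₁ walk₂ diff₁)

    sharedArc-sameShift : Traverses u v P₁ → Traverses u v P₂ → x ∈ P₁ → x ∈ P₂ →
      SameShift (d₁ x) (d₁ u) (d₂ x) (d₂ u)
    sharedArc-sameShift {u} {v} {x} u→v₁ u→v₂ x∈P₁ x∈P₂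
      with u∈P₁ , v∈P₁ ← traverses⇒∈ u→v₁
      with u∈P₂ , v∈P₂ ← traverses⇒∈ u→v₂ =
      sameShift-stable {d₁ x} {d₁ u} {d₁ v} {d₂ x} {d₂ u} {d₂ v}
        (w-pos (linked-traverses (path-linked (dagPath⇒path p₁)) u→v₁))
        (prefixWeight-traverses (path-unique p₁) u→v₁)
        (prefixWeight-traverses (path-unique p₂) u→v₂)
        (common-shift x∈P₁ x∈P₂ u∈P₁ u∈P₂) (common-shift x∈P₁ x∈P₂ v∈P₁ v∈P₂)

    sharedArc⇒firstCommon-≡ : Traverses u v P₁ → Traverses u v P₂ →
      FirstCommon x P₁ P₂ → FirstCommon y P₂ P₁ → x ≡ y
    sharedArc⇒firstCommon-≡ {u} {x = f} {b} u→v₁ u→v₂ f-first b-first with f ≟ b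
    ... | yes f≡b = f≡b
    ... | no f≢b = ⊥-elim (ℚ.<-irrefl same (ℚ.+-mono-< d₁f<d₁b d₂b<d₂f))
      where
      f∈P₁ : f ∈ P₁
      f∈P₁ = firstCommon⇒∈ f-first
      f∈P₂ : f ∈ P₂
      f∈P₂ = proj₁ f-first
      b∈P₁ : b ∈ P₁
      b∈P₁ = proj₁ b-first
      b∈P₂ : b ∈ P₂
      b∈P₂ = firstCommon⇒∈ b-first
      same : SameShift (d₁ f) (d₁ b) (d₂ f) (d₂ b)
      same = sameShift-trans {d₁ f} {d₁ b} {d₁ u} {d₂ f} {d₂ b} {d₂ u}
        (sharedArc-sameShift u→v₁ u→v₂ f∈P₁ f∈P₂) (sharedArc-sameShift u→v₁ u→v₂ b∈P₁ b∈P₂)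
      d₁f<d₁b : d₁ f < d₁ b
      d₁f<d₁b = prefixWeight-< (dagPath⇒path p₁) (firstCommon-precedes f-first b∈P₁ b∈P₂) f≢b
      d₂b<d₂f : d₂ b < d₂ f
      d₂b<d₂f = prefixWeight-< (dagPath⇒path p₂) (firstCommon-precedes b-first f∈P₂ f∈P₁)
                               (f≢b ∘ sym)

lemma27 : (G : WGraph) (s₁ t₁ s₂ t₂ : Fin (WGraph.n G)) (P₁ P₂ : List (Fin (WGraph.n G))) →
    EdgeAgreeing G s₁ t₁ s₂ t₂ P₁ P₂ → Agree P₁ P₂
lemma27 G s₁ t₁ s₂ t₂ P₁ P₂ (p₁ , p₂ , u , v , u→v₁ , u→v₂)
  with u∈P₁ , v∈P₁ ← traverses⇒∈ u→v₁
  with u∈P₂ , v∈P₂ ← traverses⇒∈ u→v₂ =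
  (u , v , unique-traverses (path-unique p₁) u→v₁ , u∈P₁ , u∈P₂ , v∈P₁ , v∈P₂) , first₁⇒first₂
  where
  first₁⇒first₂ : ∀ f → FirstCommon f P₁ P₂ → FirstCommon f P₂ P₁
  first₁⇒first₂ f f-first with b , b-first ← firstCommon-exists _≟_ P₂ P₁ u∈P₂ u∈P₁ =
    subst (λ z → FirstCommon z P₂ P₁)
          (sym (sharedArc⇒firstCommon-≡ G p₁ p₂ u→v₁ u→v₂ f-first b-first)) b-first
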